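{- The Robertson graph (the unique $19$-vertex $4$-regular graph of girth $5$, i.e. the $(4,5)$-cage) admits a total coloring with the five colors $\{0,1,2,3,4\}$ which is not efficient.
   Context: A total coloring assigns colors to vertices and edges so that adjacent vertices, edges sharing an endpoint, and an edge and its endpoints receive different colors. For a connected $k$-regular graph (here $k=4$), a total coloring with colors $\{0,\dots,k\}$ is efficient if for every vertex $v$ the vertices of the closed neighborhood $N[v]$ receive pairwise distinct colors and each vertex color class is an efficient dominating set (an independent set $S$ such that every vertex outside $S$ has exactly one neighbor in $S$). -}

module Defs where

open import Data.Nat using (ℕ; zero; suc)
open import Data.Fin using (Fin; toℕ)
open import Data.Bool using (Bool; true; false; _∧_; _∨_; T)
open import Data.List using (List; []; _∷_)
open import Data.Bool.ListAction using (any)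
open import Data.Sum using (_⊎_)
open import Data.Product using (_×_; _,_; ∃; ∃-syntax)
open import Data.Nat using (_≡ᵇ_)
open import Relation.Binary.PropositionalEquality using (_≡_; _≢_)
open import Relation.Nullary using (¬_)

record Graph (n : ℕ) : Set₁ where
  field
    Adj : Fin n → Fin n → Set

open Graph public

-- The Robertson graph: vertices 0..18, the Hamiltonian cycle
-- 0-1-...-18-0 plus 19 chords.  (This graph is 4-regular with girth 5
-- on 19 vertices, hence it is the unique (4,5)-cage.)

robertsonEdges : List (ℕ × ℕ)
robertsonEdges =
  (0 , 1) ∷ (1 , 2) ∷ (2 , 3) ∷ (3 , 4) ∷ (4 , 5) ∷ (5 , 6) ∷ (6 , 7) ∷
  (7 , 8) ∷ (8 , 9) ∷ (9 , 10) ∷ (10 , 11) ∷ (11 , 12) ∷ (12 , 13) ∷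
  (13 , 14) ∷ (14 , 15) ∷ (15 , 16) ∷ (16 , 17) ∷ (17 , 18) ∷ (18 , 0) ∷
  (0 , 4) ∷ (0 , 7) ∷ (1 , 9) ∷ (1 , 12) ∷ (2 , 6) ∷ (2 , 14) ∷
  (3 , 8) ∷ (3 , 11) ∷ (4 , 15) ∷ (5 , 13) ∷ (5 , 17) ∷ (6 , 10) ∷
  (7 , 16) ∷ (8 , 13) ∷ (9 , 17) ∷ (10 , 15) ∷ (11 , 18) ∷ (12 , 16) ∷
  (14 , 18) ∷ []

robertsonAdjᵇ : Fin 19 → Fin 19 → Bool
robertsonAdjᵇ u v = any match robertsonEdges
  where
  match : ℕ × ℕ → Bool
  match (a , b) = ((toℕ u ≡ᵇ a) ∧ (toℕ v ≡ᵇ b)) ∨ ((toℕ u ≡ᵇ b) ∧ (toℕ v ≡ᵇ a))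

Robertson : Graph 19
Robertson = record { Adj = λ u v → T (robertsonAdjᵇ u v) }

-- A vertex coloring c and an edge coloring e; e u v is the color of the
-- edge uv (only meaningful when u and v are adjacent, and required to be
-- symmetric there).

record TotalColoring {n : ℕ} (G : Graph n) (m : ℕ) : Set where
  field
    vcol : Fin n → Fin m
    ecol : Fin n → Fin n → Fin m
    ecol-sym   : ∀ u v → Adj G u v → ecol u v ≡ ecol v u
    vertex-ok  : ∀ u v → Adj G u v → vcol u ≢ vcol v
    edge-ok    : ∀ u v w → Adj G u v → Adj G u w → v ≢ w → ecol u v ≢ ecol u w
    incident-ok : ∀ u v → Adj G u v → vcol u ≢ ecol u v × vcol v ≢ ecol u v

open TotalColoring public

Independent : ∀ {n} → Graph n → (Fin n → Set) → Set
Independent G S = ∀ u v → S u → S v → ¬ Adj G u v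

EfficientDominating : ∀ {n} → Graph n → (Fin n → Set) → Set
EfficientDominating G S =
  Independent G S ×
  (∀ v → ¬ S v →
     ∃[ u ] (Adj G v u × S u × (∀ w → Adj G v w → S w → w ≡ u)))

InClosedNbhd : ∀ {n} → Graph n → Fin n → Fin n → Set
InClosedNbhd G v u = (u ≡ v) ⊎ Adj G v u

-- Efficient total coloring (for a k-regular graph, colors {0..k})
Efficient : ∀ {n m} {G : Graph n} → TotalColoring G m → Set
Efficient {n} {m} {G} tc =
  (∀ v x y → InClosedNbhd G v x → InClosedNbhd G v y → x ≢ y →
     vcol tc x ≢ vcol tc y) ×
  (∀ (i : Fin m) → EfficientDominating G (λ v → vcol tc v ≡ i))

{-# OPTIONS --safe #-}
module Submission where

-- No 5-total-colouring of the Robertson graph can be efficient: in a 4-regular graph an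
-- efficient dominating set has exactly n/5 vertices, and 5 does not divide 19. In the
-- colouring below the failure is already local: vertex 1 has the two neighbours 0 and 9,
-- both of colour 0, so its closed neighbourhood is not rainbow.

open import Defs
open import Data.Bool using (_∧_; _∨_; if_then_else_)
open import Data.Fin using (Fin; toℕ; #_; _≟_)
open import Data.Fin.Properties using (all?)
open import Data.List using (List; []; _∷_)
open import Data.Nat using (ℕ; _≡ᵇ_)
open import Data.Product using (Σ; _×_; _,_)
open import Data.Sum using (inj₂)
open import Data.Vec using (Vec; []; _∷_; lookup)
open import Relation.Binary.PropositionalEquality using (_≡_; _≢_; refl)
open import Relation.Nullary using (¬_; Dec; ¬?)
open import Relation.Nullary.Decidable using (T?; _×-dec_; _→-dec_; from-yes)

module TotalColoringAxioms {n m} (G : Graph n) (adj? : ∀ u v → Dec (Adj G u v))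
                           (vcol : Fin n → Fin m) (ecol : Fin n → Fin n → Fin m) where

  ecol-sym? : Dec (∀ u v → Adj G u v → ecol u v ≡ ecol v u)
  ecol-sym? = all? λ u → all? λ v → adj? u v →-dec ecol u v ≟ ecol v u

  vertex-ok? : Dec (∀ u v → Adj G u v → vcol u ≢ vcol v)
  vertex-ok? = all? λ u → all? λ v → adj? u v →-dec ¬? (vcol u ≟ vcol v)

  edge-ok? : Dec (∀ u v w → Adj G u v → Adj G u w → v ≢ w → ecol u v ≢ ecol u w)
  edge-ok? = all? λ u → all? λ v → all? λ w →
    adj? u v →-dec adj? u w →-dec ¬? (v ≟ w) →-dec ¬? (ecol u v ≟ ecol u w)

  incident-ok? : Dec (∀ u v → Adj G u v → vcol u ≢ ecol u v × vcol v ≢ ecol u v)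
  incident-ok? = all? λ u → all? λ v →
    adj? u v →-dec ¬? (vcol u ≟ ecol u v) ×-dec ¬? (vcol v ≟ ecol u v)

repeatedNeighbourColour⇒¬Efficient :
  ∀ {n m} {G : Graph n} (tc : TotalColoring G m) {v x y : Fin n} →
  Adj G v x → Adj G v y → x ≢ y → vcol tc x ≡ vcol tc y → ¬ Efficient tc
repeatedNeighbourColour⇒¬Efficient tc v~x v~y x≢y cx≡cy (closedNbhdRainbow , _) =
  closedNbhdRainbow _ _ _ (inj₂ v~x) (inj₂ v~y) x≢y cx≡cy

vertexColours : Vec (Fin 5) 19
vertexColours =
  # 0 ∷ # 1 ∷ # 2 ∷ # 0 ∷ # 4 ∷ # 1 ∷ # 0 ∷ # 3 ∷ # 1 ∷ # 0 ∷
  # 2 ∷ # 1 ∷ # 0 ∷ # 2 ∷ # 1 ∷ # 3 ∷ # 2 ∷ # 3 ∷ # 2 ∷ []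

edgeColours : List (ℕ × ℕ × Fin 5)
edgeColours =
  (0 , 1 , # 2) ∷ (1 , 2 , # 0) ∷ (2 , 3 , # 1) ∷ (3 , 4 , # 2) ∷ (4 , 5 , # 0) ∷
  (5 , 6 , # 4) ∷ (6 , 7 , # 2) ∷ (7 , 8 , # 0) ∷ (8 , 9 , # 2) ∷ (9 , 10 , # 4) ∷
  (10 , 11 , # 3) ∷ (11 , 12 , # 2) ∷ (12 , 13 , # 1) ∷ (13 , 14 , # 0) ∷ (14 , 15 , # 2) ∷
  (15 , 16 , # 4) ∷ (16 , 17 , # 0) ∷ (17 , 18 , # 4) ∷ (18 , 0 , # 1) ∷
  (0 , 4 , # 3) ∷ (0 , 7 , # 4) ∷ (1 , 9 , # 3) ∷ (1 , 12 , # 4) ∷ (2 , 6 , # 3) ∷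
  (2 , 14 , # 4) ∷ (3 , 8 , # 3) ∷ (3 , 11 , # 4) ∷ (4 , 15 , # 1) ∷ (5 , 13 , # 3) ∷
  (5 , 17 , # 2) ∷ (6 , 10 , # 1) ∷ (7 , 16 , # 1) ∷ (8 , 13 , # 4) ∷ (9 , 17 , # 1) ∷
  (10 , 15 , # 0) ∷ (11 , 18 , # 0) ∷ (12 , 16 , # 3) ∷ (14 , 18 , # 3) ∷ []

-- Pairs that are not edges get the junk colour 0.
edgeColour : Fin 19 → Fin 19 → Fin 5
edgeColour u v = colourIn edgeColours
  where
  colourIn : List (ℕ × ℕ × Fin 5) → Fin 5
  colourIn [] = # 0
  colourIn ((a , b , c) ∷ rest) =
    if ((toℕ u ≡ᵇ a) ∧ (toℕ v ≡ᵇ b)) ∨ ((toℕ u ≡ᵇ b) ∧ (toℕ v ≡ᵇ a)) then c else colourIn rest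

robertsonAdj? : ∀ u v → Dec (Adj Robertson u v)
robertsonAdj? u v = T? (robertsonAdjᵇ u v)

open TotalColoringAxioms Robertson robertsonAdj? (lookup vertexColours) edgeColour

robertsonTotalColoring : TotalColoring Robertson 5
robertsonTotalColoring = record
  { vcol        = lookup vertexColours
  ; ecol        = edgeColour
  ; ecol-sym    = from-yes ecol-sym?
  ; vertex-ok   = from-yes vertex-ok?
  ; edge-ok     = from-yes edge-ok?
  ; incident-ok = from-yes incident-ok?
  }

theorem37 : Σ (TotalColoring Robertson 5) (λ tc → ¬ Efficient tc)
theorem37 = robertsonTotalColoring ,
  repeatedNeighbourColour⇒¬Efficient robertsonTotalColoring {v = # 1} {x = # 0} {y = # 9}
    _ _ (λ ()) refl
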